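{- Let $\mathcal G$ be a finite abelian group, $\mathcal G'$ a subgroup of $\mathcal G$, $G$ a finite simple graph and $X\subseteq V(G)$ with $|X|<D(\mathcal G/\mathcal G')$. If $G$ is zero-forcing for $\mathcal G$, then some connected component of $G-X$ is zero-forcing for $\mathcal G'$.
   Context: For a finite abelian group $\mathcal H$, the Davenport constant $D(\mathcal H)$ is the minimum integer $n$ such that every sequence of $n$ elements of $\mathcal H$ has a non-empty subsequence summing to $0$. For a finite abelian group $(\mathcal G,+,0)$, a $\mathcal G$-labeling of a graph $G$ is a map $\ell: V(G)\to\mathcal G$, extended to vertex sets by $\ell(A)=\sum_{x\in A}\ell(x)$. A set $A\subseteq V(G)$ is called connected if $G[A]$ is connected. $(G,\ell)$ is zero-avoiding if $\ell(A)\neq 0$ for every non-empty connected $A\subseteq V(G)$. $G$ is zero-forcing for $\mathcal G$ if there is no $\mathcal G$-labeling $\ell$ of $G$ with $(G,\ell)$ zero-avoiding. -}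

module Defs where

open import Level using (Level; _⊔_)
open import Algebra.Bundles using (AbelianGroup)
open import Algebra.Structures using (IsAbelianGroup)
import Algebra.Properties.Group as GroupProps
import Algebra.Properties.CommutativeSemigroup as CSProps
import Relation.Binary.Reasoning.Setoid as SetoidReasoning
open import Data.Nat using (ℕ; _≤_)
open import Data.Fin using (Fin; zero; suc)
open import Data.Fin.Subset using (Subset; _∈_; _⊆_; Nonempty)
open import Data.Vec using ([]; _∷_)
open import Data.Bool using (Bool; true; false)
open import Data.Product using (Σ; _×_; _,_)
open import Function using (_∘_)
open import Relation.Nullary using (¬_)
open import Relation.Binary.PropositionalEquality using (_≡_)

module _ {c ℓ} (𝒢 : AbelianGroup c ℓ) where
  open AbelianGroup 𝒢

  record IsFinite : Set (c ⊔ ℓ) where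
    field
      size      : ℕ
      enum      : Fin size → Carrier
      enum-surj : ∀ x → Σ (Fin size) λ i → enum i ≈ x
      enum-inj  : ∀ i j → enum i ≈ enum j → i ≡ j

  record IsSubgroup {p} (P : Carrier → Set p) : Set (c ⊔ ℓ ⊔ p) where
    field
      resp     : ∀ {x y} → x ≈ y → P x → P y
      ε-closed : P ε
      ∙-closed : ∀ {x y} → P x → P y → P (x ∙ y)
      ⁻¹-closed : ∀ {x} → P x → P (x ⁻¹)

  sumOver : ∀ {n} → Subset n → (Fin n → Carrier) → Carrier
  sumOver []          s = ε
  sumOver (true ∷ A)  s = s zero ∙ sumOver A (s ∘ suc)
  sumOver (false ∷ A) s = sumOver A (s ∘ suc)

  ZeroSumProperty : ℕ → Set (c ⊔ ℓ)
  ZeroSumProperty n = ∀ (s : Fin n → Carrier) →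
    Σ (Subset n) λ I → Nonempty I × (sumOver I s ≈ ε)

  IsDavenportConstant : ℕ → Set (c ⊔ ℓ)
  IsDavenportConstant d = ZeroSumProperty d × (∀ m → ZeroSumProperty m → d ≤ m)

-- Quotient group 𝒢 / 𝒢' (same carrier, x ~ y iff x - y ∈ 𝒢')

module _ {c ℓ p} (𝒢 : AbelianGroup c ℓ) {P : AbelianGroup.Carrier 𝒢 → Set p}
         (sg : IsSubgroup 𝒢 P) where
  open AbelianGroup 𝒢
  open IsSubgroup sg
  open GroupProps group using (⁻¹-anti-homo-//; ⁻¹-involutive)
  open CSProps commutativeSemigroup using (interchange)
  open SetoidReasoning setoid

  private
    _~_ : Carrier → Carrier → Set p
    x ~ y = P (x ∙ y ⁻¹)

    ≈⇒~ : ∀ {x y} → x ≈ y → x ~ y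
    ≈⇒~ {x} {y} x≈y = resp (begin
      ε           ≈⟨ sym (inverseʳ y) ⟩
      y ∙ y ⁻¹    ≈⟨ ∙-congʳ (sym x≈y) ⟩
      x ∙ y ⁻¹    ∎) ε-closed

    ~-sym : ∀ {x y} → x ~ y → y ~ x
    ~-sym {x} {y} h = resp (⁻¹-anti-homo-// x y) (⁻¹-closed h)

    ~-trans : ∀ {x y z} → x ~ y → y ~ z → x ~ z
    ~-trans {x} {y} {z} h k = resp (begin
      (x ∙ y ⁻¹) ∙ (y ∙ z ⁻¹)   ≈⟨ assoc x (y ⁻¹) (y ∙ z ⁻¹) ⟩
      x ∙ (y ⁻¹ ∙ (y ∙ z ⁻¹))   ≈⟨ ∙-congˡ (sym (assoc (y ⁻¹) y (z ⁻¹))) ⟩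
      x ∙ ((y ⁻¹ ∙ y) ∙ z ⁻¹)   ≈⟨ ∙-congˡ (∙-congʳ (inverseˡ y)) ⟩
      x ∙ (ε ∙ z ⁻¹)            ≈⟨ ∙-congˡ (identityˡ (z ⁻¹)) ⟩
      x ∙ z ⁻¹                  ∎) (∙-closed h k)

    ~-∙-cong : ∀ {x y u v} → x ~ y → u ~ v → (x ∙ u) ~ (y ∙ v)
    ~-∙-cong {x} {y} {u} {v} h k = resp (begin
      (x ∙ y ⁻¹) ∙ (u ∙ v ⁻¹)   ≈⟨ interchange x (y ⁻¹) u (v ⁻¹) ⟩
      (x ∙ u) ∙ (y ⁻¹ ∙ v ⁻¹)   ≈⟨ ∙-congˡ (comm (y ⁻¹) (v ⁻¹)) ⟩
      (x ∙ u) ∙ (v ⁻¹ ∙ y ⁻¹)   ≈⟨ ∙-congˡ (sym (GroupProps.⁻¹-anti-homo-∙ group y v)) ⟩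
      (x ∙ u) ∙ (y ∙ v) ⁻¹      ∎) (∙-closed h k)

    ~-⁻¹-cong : ∀ {x y} → x ~ y → (x ⁻¹) ~ (y ⁻¹)
    ~-⁻¹-cong {x} {y} h = resp (begin
      y ∙ x ⁻¹            ≈⟨ comm y (x ⁻¹) ⟩
      x ⁻¹ ∙ y            ≈⟨ ∙-congˡ (sym (⁻¹-involutive y)) ⟩
      x ⁻¹ ∙ y ⁻¹ ⁻¹      ∎) (~-sym h)

  quotient : AbelianGroup c p
  quotient = record
    { Carrier = Carrier
    ; _≈_ = _~_
    ; _∙_ = _∙_
    ; ε = ε
    ; _⁻¹ = _⁻¹
    ; isAbelianGroup = record
      { isGroup = record
        { isMonoid = record
          { isSemigroup = record
            { isMagma = record
              { isEquivalence = record
                { refl = ≈⇒~ refl ; sym = ~-sym ; trans = ~-trans }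
              ; ∙-cong = ~-∙-cong }
            ; assoc = λ x y z → ≈⇒~ (assoc x y z) }
          ; identity = (λ x → ≈⇒~ (identityˡ x)) , (λ x → ≈⇒~ (identityʳ x)) }
        ; inverse = (λ x → ≈⇒~ (inverseˡ x)) , (λ x → ≈⇒~ (inverseʳ x))
        ; ⁻¹-cong = ~-⁻¹-cong }
      ; comm = λ x y → ≈⇒~ (comm x y) }
    }

record Graph : Set where
  field
    n      : ℕ
    adj    : Fin n → Fin n → Bool
    sym    : ∀ x y → adj x y ≡ adj y x
    irrefl : ∀ x → adj x x ≡ false

module _ (G : Graph) where
  open Graph G

  -- Walks x = v0, v1, ..., vk = y in G with v1..vk in A.
  data PathIn (A : Subset n) : Fin n → Fin n → Set where
    here : ∀ {x} → PathIn A x x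
    step : ∀ {x y z} → adj x y ≡ true → y ∈ A → PathIn A y z → PathIn A x z

  Connected : Subset n → Set
  Connected A = ∀ x y → x ∈ A → y ∈ A → PathIn A x y

  -- C is a connected component of G[W] (for G - X take W = ∁ X).
  IsComponentOf : Subset n → Subset n → Set
  IsComponentOf W C =
    Nonempty C × C ⊆ W × Connected C ×
    (∀ C′ → C ⊆ C′ → C′ ⊆ W → Connected C′ → C′ ⊆ C)

  module _ {c ℓ} (𝒢 : AbelianGroup c ℓ) where
    open AbelianGroup 𝒢 using (Carrier; _≈_; ε)

    ZeroAvoidingOn : Subset n → (Fin n → Carrier) → Set ℓ
    ZeroAvoidingOn W lab = ∀ A → A ⊆ W → Nonempty A → Connected A →
      ¬ (sumOver 𝒢 A lab ≈ ε)

    ZeroForcingOn : ∀ {p} → Subset n → (Carrier → Set p) → Set (c ⊔ ℓ ⊔ p)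
    ZeroForcingOn W P = ∀ (lab : Fin n → Carrier) →
      (∀ v → v ∈ W → P (lab v)) → ¬ ZeroAvoidingOn W lab

    ZeroAvoiding : (Fin n → Carrier) → Set ℓ
    ZeroAvoiding lab = ∀ A → Nonempty A → Connected A → ¬ (sumOver 𝒢 A lab ≈ ε)

    ZeroForcing : Set (c ⊔ ℓ)
    ZeroForcing = ∀ (lab : Fin n → Carrier) → ¬ ZeroAvoiding lab

-- Suppose every component C of G - X carries a labelling with values in 𝒢′
-- that is zero-avoiding on C. Since ∣ X ∣ < D(𝒢/𝒢′), there is a sequence of
-- length ∣ X ∣ without non-empty subsequence summing into 𝒢′; put it on X.
-- As the labels off X lie in 𝒢′, a connected set A meeting X has
-- ℓ(A) − ℓ(A ∩ X) ∈ 𝒢′ while ℓ(A ∩ X) ∉ 𝒢′, so ℓ(A) ≠ 0; a connected set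
-- missing X lies in a single component. So G would not be zero-forcing.
--
-- Everything is constructive: finiteness of 𝒢 makes all the relevant
-- existence statements decidable by exhaustive search, and membership in 𝒢′
-- is itself decidable thanks to the Davenport constant of the quotient.

module Submission where

open import Defs
open import Level using (_⊔_)
open import Algebra.Bundles using (AbelianGroup)
import Algebra.Properties.Group as GroupProperties
open import Data.Bool using (true; false)
open import Data.Bool.Properties using (T-≡) renaming (_≟_ to _≟ᵇ_)
open import Data.Empty using (⊥-elim)
open import Data.Fin using (Fin; zero; suc; _≟_)
open import Data.Fin.Properties using (any?; all?)
open import Data.Fin.Subset using (Subset; ∁; ∣_∣; _∈_; _∉_; _⊆_; Nonempty; Empty; _∩_; _-_)
open import Data.Fin.Subset.Properties
  using (_∈?_; _⊆?_; nonempty?; anySubset?; drop-∷-Empty; drop-there; ∣p∣≤n; x∈p⇒∣p-x∣<∣p∣;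
         x∈p∧x≢y⇒x∈p-y; p─q⊆p; x∈p∩q⁺; x∈p∩q⁻; x∈∁p⇒x∉p; x∉p⇒x∈∁p)
open import Data.Nat using (ℕ; zero; suc; _<_; s≤s)
open import Data.Nat.Properties using (<-irrefl; <-≤-trans)
open import Data.Product using (Σ; _×_; _,_; proj₁; proj₂; ∃; map₂)
open import Data.Sum using (_⊎_; inj₁; inj₂; [_,_]′)
open import Data.Vec using (Vec; []; _∷_; lookup; tabulate; here; there)
open import Data.Vec.Properties using (lookup∘tabulate; tabulate-cong; []=⇒lookup; lookup⇒[]=)
open import Function using (_∘_; _⇔_; mk⇔; Equivalence)
open import Relation.Nullary using (¬_; Dec; yes; no; does)
open import Relation.Nullary.Decidable
  using (_×-dec_; _→-dec_; ¬?; map′; dec-true; does-⇔; isYes≗does; toWitness; decidable-stable)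
open import Relation.Binary.PropositionalEquality using (_≡_; _≢_; cong)
import Relation.Binary.PropositionalEquality as ≡
import Relation.Binary.Reasoning.Setoid as SetoidReasoning

open Equivalence using (to; from)

anyVec? : ∀ {k m q} {Q : Vec (Fin k) m → Set q} → (∀ v → Dec (Q v)) → Dec (∃ Q)
anyVec? {m = zero}  Q? = map′ ([] ,_) (λ { ([] , q) → q }) (Q? [])
anyVec? {m = suc m} Q? =
  map′ (λ (i , v , q) → i ∷ v , q) (λ { (i ∷ v , q) → i , v , q })
       (any? λ i → anyVec? (Q? ∘ (i ∷_)))

compress : ∀ {n} (X : Subset n) → Subset n → Subset ∣ X ∣
compress []          []      = []
compress (true ∷ X)  (a ∷ A) = a ∷ compress X A
compress (false ∷ X) (a ∷ A) = compress X A

compress-nonempty : ∀ {n} (X A : Subset n) → Nonempty (A ∩ X) → Nonempty (compress X A)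
compress-nonempty (true ∷ X)  (true ∷ A)  (zero , here)      = zero , here
compress-nonempty (true ∷ X)  (a ∷ A)     (suc i , there i∈)
  with compress-nonempty X A (i , i∈)
... | j , j∈ = suc j , there j∈
compress-nonempty (false ∷ X) (true ∷ A)  (suc i , there i∈) = compress-nonempty X A (i , i∈)
compress-nonempty (false ∷ X) (false ∷ A) (suc i , there i∈) = compress-nonempty X A (i , i∈)

module _ {c ℓ} (H : AbelianGroup c ℓ) where
  open AbelianGroup H
  open SetoidReasoning setoid

  sumOver-cong : ∀ {n} (A : Subset n) {f g : Fin n → Carrier} →
    (∀ i → i ∈ A → f i ≈ g i) → sumOver H A f ≈ sumOver H A g
  sumOver-cong []          f≈g = refl
  sumOver-cong (true ∷ A)  f≈g = ∙-cong (f≈g zero here) (sumOver-cong A (λ i → f≈g (suc i) ∘ there))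
  sumOver-cong (false ∷ A) f≈g = sumOver-cong A (λ i → f≈g (suc i) ∘ there)

  sumOver-empty : ∀ {n} (A : Subset n) (f : Fin n → Carrier) → Empty A → sumOver H A f ≈ ε
  sumOver-empty []          f A=∅ = refl
  sumOver-empty (true ∷ A)  f A=∅ = ⊥-elim (A=∅ (zero , here))
  sumOver-empty (false ∷ A) f A=∅ = sumOver-empty A (f ∘ suc) (drop-∷-Empty A=∅)

  sumOver-∩ : ∀ {n} (A X : Subset n) (f : Fin n → Carrier) →
    (∀ i → i ∉ X → f i ≈ ε) → sumOver H A f ≈ sumOver H (A ∩ X) f
  sumOver-∩ []          []          f f≈ε = refl
  sumOver-∩ (true ∷ A)  (true ∷ X)  f f≈ε =
    ∙-congˡ (sumOver-∩ A X (f ∘ suc) (λ i i∉X → f≈ε (suc i) (i∉X ∘ drop-there)))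
  sumOver-∩ (true ∷ A)  (false ∷ X) f f≈ε = begin
    f zero ∙ sumOver H A (f ∘ suc)  ≈⟨ ∙-congʳ (f≈ε zero λ ()) ⟩
    ε ∙ sumOver H A (f ∘ suc)       ≈⟨ identityˡ _ ⟩
    sumOver H A (f ∘ suc)           ≈⟨ sumOver-∩ A X (f ∘ suc) (λ i i∉X → f≈ε (suc i) (i∉X ∘ drop-there)) ⟩
    sumOver H (A ∩ X) (f ∘ suc)     ∎
  sumOver-∩ (false ∷ A) (_ ∷ X)     f f≈ε =
    sumOver-∩ A X (f ∘ suc) (λ i i∉X → f≈ε (suc i) (i∉X ∘ drop-there))

  spread : ∀ {n} (X : Subset n) → (Fin ∣ X ∣ → Carrier) → Fin n → Carrier
  spread (true ∷ X)  s zero    = s zero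
  spread (true ∷ X)  s (suc i) = spread X (s ∘ suc) i
  spread (false ∷ X) s zero    = ε
  spread (false ∷ X) s (suc i) = spread X s i

  sumOver-spread : ∀ {n} (X A : Subset n) (s : Fin ∣ X ∣ → Carrier) →
    sumOver H (A ∩ X) (spread X s) ≈ sumOver H (compress X A) s
  sumOver-spread []          []          s = refl
  sumOver-spread (true ∷ X)  (true ∷ A)  s = ∙-congˡ (sumOver-spread X A (s ∘ suc))
  sumOver-spread (true ∷ X)  (false ∷ A) s = sumOver-spread X A (s ∘ suc)
  sumOver-spread (false ∷ X) (true ∷ A)  s = sumOver-spread X A s
  sumOver-spread (false ∷ X) (false ∷ A) s = sumOver-spread X A s

module _ {c ℓ p} (𝒢 : AbelianGroup c ℓ) (P : AbelianGroup.Carrier 𝒢 → Set p) where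
  open AbelianGroup 𝒢

  HasSubsumIn : ∀ {m} → (Fin m → Carrier) → Set p
  HasSubsumIn {m} s = Σ (Subset m) λ I → Nonempty I × P (sumOver 𝒢 I s)

module _ {c ℓ p} {𝒢 : AbelianGroup c ℓ} {P : AbelianGroup.Carrier 𝒢 → Set p}
         (sg : IsSubgroup 𝒢 P) where
  open AbelianGroup 𝒢
  open IsSubgroup sg
  open GroupProperties group using (ε⁻¹≈ε; \\-leftDividesʳ)
  open SetoidReasoning setoid
  private
    𝒬 = quotient 𝒢 sg
    module 𝒬 = AbelianGroup 𝒬

  HasSubsumIn-cong : ∀ {m} {s t : Fin m → Carrier} → (∀ i → s i ≈ t i) →
    HasSubsumIn 𝒢 P s → HasSubsumIn 𝒢 P t
  HasSubsumIn-cong s≈t (I , ne , pI) = I , ne , resp (sumOver-cong 𝒢 I (λ i _ → s≈t i)) pI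

  sumOver-quotient : ∀ {n} (A : Subset n) (f : Fin n → Carrier) → sumOver 𝒬 A f ≡ sumOver 𝒢 A f
  sumOver-quotient []          f = ≡.refl
  sumOver-quotient (true ∷ A)  f = cong (f zero ∙_) (sumOver-quotient A (f ∘ suc))
  sumOver-quotient (false ∷ A) f = sumOver-quotient A (f ∘ suc)

  quotient-≈ε⇔ : ∀ x → x 𝒬.≈ 𝒬.ε ⇔ P x
  quotient-≈ε⇔ x = mk⇔ (resp x∙ε⁻¹≈x) (resp (sym x∙ε⁻¹≈x))
    where
    x∙ε⁻¹≈x : x ∙ ε ⁻¹ ≈ x
    x∙ε⁻¹≈x = trans (∙-congˡ ε⁻¹≈ε) (identityʳ x)

  quotient-sum≈ε⇔ : ∀ {n} (A : Subset n) (f : Fin n → Carrier) →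
    sumOver 𝒬 A f 𝒬.≈ 𝒬.ε ⇔ P (sumOver 𝒢 A f)
  quotient-sum≈ε⇔ A f rewrite sumOver-quotient A f = quotient-≈ε⇔ (sumOver 𝒢 A f)

  zeroSumProperty⇔ : ∀ m → ZeroSumProperty 𝒬 m ⇔ (∀ (s : Fin m → Carrier) → HasSubsumIn 𝒢 P s)
  zeroSumProperty⇔ m = mk⇔
    (λ zsp s → map₂ (λ {I} → map₂ (to (quotient-sum≈ε⇔ I s))) (zsp s))
    (λ has s → map₂ (λ {I} → map₂ (from (quotient-sum≈ε⇔ I s))) (has s))

  subsum-head-or-tail : ∀ {m} (t : Fin (suc m) → Carrier) → P (t zero) →
    (h : HasSubsumIn 𝒢 P t) → sumOver 𝒢 (proj₁ h) t ≈ t zero ⊎ HasSubsumIn 𝒢 P (t ∘ suc)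
  subsum-head-or-tail t pt₀ (false ∷ J , (suc j , there j∈J) , pJ) = inj₂ (J , (j , j∈J) , pJ)
  subsum-head-or-tail t pt₀ (true ∷ J  , _                   , pI) with nonempty? J
  ... | yes neJ = inj₂ (J , neJ , resp (\\-leftDividesʳ (t zero) _) (∙-closed (⁻¹-closed pt₀) pI))
  ... | no J=∅  = inj₁ (begin
    t zero ∙ sumOver 𝒢 J (t ∘ suc)  ≈⟨ ∙-congˡ (sumOver-empty 𝒢 J (t ∘ suc) J=∅) ⟩
    t zero ∙ ε                      ≈⟨ identityʳ (t zero) ⟩
    t zero                          ∎)

  sumOver-∩-∈ : ∀ {n} (A X : Subset n) (f : Fin n → Carrier) →
    (∀ i → i ∉ X → P (f i)) → P (sumOver 𝒢 A f) → P (sumOver 𝒢 (A ∩ X) f)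
  sumOver-∩-∈ A X f outside∈P A∈P = to (quotient-sum≈ε⇔ (A ∩ X) f)
    (𝒬.trans (𝒬.sym (sumOver-∩ 𝒬 A X f λ i i∉X → from (quotient-≈ε⇔ (f i)) (outside∈P i i∉X)))
             (from (quotient-sum≈ε⇔ A f) A∈P))

module Finite {c ℓ} {𝒢 : AbelianGroup c ℓ} (fin : IsFinite 𝒢) where
  open AbelianGroup 𝒢
  open IsFinite fin

  index : Carrier → Fin size
  index x = proj₁ (enum-surj x)

  enum-index : ∀ x → enum (index x) ≈ x
  enum-index x = proj₂ (enum-surj x)

  decode : ∀ {m} → Vec (Fin size) m → Fin m → Carrier
  decode v = enum ∘ lookup v

  encode : ∀ {m} → (Fin m → Carrier) → Vec (Fin size) m
  encode f = tabulate (index ∘ f)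

  decode-encode : ∀ {m} (f : Fin m → Carrier) i → decode (encode f) i ≈ f i
  decode-encode f i rewrite lookup∘tabulate (index ∘ f) i = enum-index (f i)

  _≈?_ : ∀ x y → Dec (x ≈ y)
  x ≈? y = map′
    (λ i≡j → trans (sym (enum-index x)) (trans (reflexive (cong enum i≡j)) (enum-index y)))
    (λ x≈y → enum-inj _ _ (trans (enum-index x) (trans x≈y (sym (enum-index y)))))
    (index x ≟ index y)

  anySequence? : ∀ {m q} {Q : (Fin m → Carrier) → Set q} →
    (∀ {f g} → (∀ i → f i ≈ g i) → Q f → Q g) → (∀ f → Dec (Q f)) → Dec (∃ Q)
  anySequence? Q-resp Q? = map′
    (λ (v , q) → decode v , q)
    (λ (f , q) → encode f , Q-resp (λ i → sym (decode-encode f i)) q)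
    (anyVec? (Q? ∘ decode))

module _ {c ℓ p} {𝒢 : AbelianGroup c ℓ} (fin : IsFinite 𝒢)
         {P : AbelianGroup.Carrier 𝒢 → Set p} (sg : IsSubgroup 𝒢 P) where
  open AbelianGroup 𝒢
  open IsFinite fin using (size)
  open IsSubgroup sg
  open Finite fin
  open GroupProperties group using (⁻¹-involutive)

  -- If every sequence of length m + 1 has a P-subsum but not every sequence of
  -- length m does, then P x holds iff x ⁻¹ is the subsum chosen for some sequence.
  module ChosenSums {m} (subsum : ∀ (s : Fin (suc m) → Carrier) → HasSubsumIn 𝒢 P s)
                        (¬subsum : ¬ (∀ (s : Fin m → Carrier) → HasSubsumIn 𝒢 P s)) where
    chosenSum : Vec (Fin size) (suc m) → Carrier
    chosenSum v = sumOver 𝒢 (proj₁ (subsum (decode v))) (decode v)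

    IsChosenSum : Carrier → Set ℓ
    IsChosenSum y = ∃ λ v → chosenSum v ≈ y

    isChosenSum⇒∈ : ∀ {y} → IsChosenSum y → P y
    isChosenSum⇒∈ (v , e) = resp e (proj₂ (proj₂ (subsum (decode v))))

    prepend-subsum : ∀ {x} → P x → ¬ IsChosenSum (x ⁻¹) → ∀ s → HasSubsumIn 𝒢 P s
    prepend-subsum {x} px notChosen s =
      [ (λ chosen≈x⁻¹ → ⊥-elim (notChosen (v , trans chosen≈x⁻¹ (enum-index (x ⁻¹)))))
      , HasSubsumIn-cong sg (decode-encode s) ]′
      (subsum-head-or-tail sg (decode v) (resp (sym (enum-index (x ⁻¹))) (⁻¹-closed px))
                           (subsum (decode v)))
      where
      v : Vec (Fin size) (suc m)
      v = index (x ⁻¹) ∷ encode s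

    ∈? : ∀ x → Dec (P x)
    ∈? x = map′ (λ c → resp (⁻¹-involutive x) (⁻¹-closed (isChosenSum⇒∈ c)))
                (λ px → decidable-stable (isChosenSum? (x ⁻¹)) (¬subsum ∘ prepend-subsum px))
                (isChosenSum? (x ⁻¹))
      where
      isChosenSum? : ∀ y → Dec (IsChosenSum y)
      isChosenSum? y = anyVec? λ v → chosenSum v ≈? y

  ∈-dec : ∀ {d} → IsDavenportConstant (quotient 𝒢 sg) d → ∀ x → Dec (P x)
  ∈-dec {zero}  (zsp , _)       with zsp (λ ())
  ... | _ , (() , _) , _
  ∈-dec {suc m} (zsp , minimal) = ChosenSums.∈? (to (zeroSumProperty⇔ sg (suc m)) zsp)
    (λ subsum → <-irrefl ≡.refl (minimal m (from (zeroSumProperty⇔ sg m) subsum)))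

  zeroSumFree-sequence : ∀ {d m} → IsDavenportConstant (quotient 𝒢 sg) d → m < d →
    Σ (Fin m → Carrier) λ s → ¬ HasSubsumIn 𝒢 P s
  zeroSumFree-sequence {d} {m} dav m<d =
    decidable-stable (anySequence? (λ s≈t → _∘ HasSubsumIn-cong sg (sym ∘ s≈t)) (¬? ∘ hasSubsumIn?))
      λ ¬free → <-irrefl ≡.refl (<-≤-trans m<d (proj₂ dav m (from (zeroSumProperty⇔ sg m)
        λ s → decidable-stable (hasSubsumIn? s) λ ¬has → ¬free (s , ¬has))))
    where
    hasSubsumIn? : ∀ (s : Fin m → Carrier) → Dec (HasSubsumIn 𝒢 P s)
    hasSubsumIn? s = anySubset? λ I → nonempty? I ×-dec ∈-dec dav (sumOver 𝒢 I s)

module _ (G : Graph) where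
  open Graph G

  PathIn-mono : ∀ {A B} → A ⊆ B → ∀ {x y} → PathIn G A x y → PathIn G B x y
  PathIn-mono A⊆B here           = here
  PathIn-mono A⊆B (step e y∈A p) = step e (A⊆B y∈A) (PathIn-mono A⊆B p)

  _++ᵖ_ : ∀ {A x y z} → PathIn G A x y → PathIn G A y z → PathIn G A x z
  here         ++ᵖ q = q
  step e y∈A p ++ᵖ q = step e y∈A (p ++ᵖ q)

  PathIn-reverse : ∀ {A x y} → x ∈ A → PathIn G A x y → PathIn G A y x
  PathIn-reverse x∈A here = here
  PathIn-reverse {x = x} x∈A (step {y = w} e w∈A p) =
    PathIn-reverse w∈A p ++ᵖ step (≡.trans (sym w x) e) x∈A here

  PathIn-end∈ : ∀ {A x y} → x ∈ A → PathIn G A x y → y ∈ A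
  PathIn-end∈ x∈A here           = x∈A
  PathIn-end∈ x∈A (step e w∈A p) = PathIn-end∈ w∈A p

  PathIn-avoid : ∀ {A} z {x y} → PathIn G A x y → PathIn G (A - z) x y ⊎ PathIn G (A - z) z y
  PathIn-avoid z here = inj₁ here
  PathIn-avoid z (step {y = w} e w∈A p) with PathIn-avoid z p
  ... | inj₂ q = inj₂ q
  ... | inj₁ q with w ≟ z
  ...   | yes ≡.refl = inj₂ q
  ...   | no w≢z     = inj₁ (step e (x∈p∧x≢y⇒x∈p-y w∈A w≢z) q)

  PathIn-avoidStart : ∀ {A} z {y} → PathIn G A z y → PathIn G (A - z) z y
  PathIn-avoidStart z p with PathIn-avoid z p
  ... | inj₁ q = q
  ... | inj₂ q = q

  PathIn-step⇔ : ∀ {A x y} → x ≢ y →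
    PathIn G A x y ⇔ ∃ λ z → z ∈ A × adj x z ≡ true × PathIn G (A - z) z y
  PathIn-step⇔ {A} x≢y = mk⇔
    (λ { here → ⊥-elim (x≢y ≡.refl) ; (step {y = z} e z∈A p) → z , z∈A , e , PathIn-avoidStart z p })
    (λ (z , z∈A , e , p) → step e z∈A (PathIn-mono (p─q⊆p A _) p))

  -- Induction on a strict bound for ∣ A ∣: each step removes a vertex of A.
  pathIn?-bounded : ∀ k (A : Subset n) → ∣ A ∣ < k → ∀ x y → Dec (PathIn G A x y)
  pathIn?-bounded (suc k) A (s≤s ∣A∣≤k) x y with x ≟ y
  ... | yes ≡.refl = yes here
  ... | no x≢y     = map′ (from (PathIn-step⇔ x≢y)) (to (PathIn-step⇔ x≢y)) (any? viaNeighbour?)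
    where
    viaNeighbour? : ∀ z → Dec (z ∈ A × adj x z ≡ true × PathIn G (A - z) z y)
    viaNeighbour? z with z ∈? A
    ... | no z∉A  = no (z∉A ∘ proj₁)
    ... | yes z∈A = map′ (z∈A ,_) proj₂
      ((adj x z ≟ᵇ true) ×-dec pathIn?-bounded k (A - z) (<-≤-trans (x∈p⇒∣p-x∣<∣p∣ z∈A) ∣A∣≤k) z y)

  PathIn? : ∀ (A : Subset n) x y → Dec (PathIn G A x y)
  PathIn? A = pathIn?-bounded (suc n) A (s≤s (∣p∣≤n A))

  Connected? : ∀ (A : Subset n) → Dec (Connected G A)
  Connected? A = all? λ x → all? λ y → x ∈? A →-dec y ∈? A →-dec PathIn? A x y

  component : Subset n → Fin n → Subset n
  component W u = tabulate (does ∘ PathIn? W u)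

  ∈component⇔ : ∀ W u {w} → w ∈ component W u ⇔ PathIn G W u w
  ∈component⇔ W u {w} = mk⇔
    (λ w∈ → toWitness (from T-≡ (≡.trans (isYes≗does (PathIn? W u w))
       (≡.trans (≡.sym (lookup∘tabulate (does ∘ PathIn? W u) w)) ([]=⇒lookup w∈)))))
    (λ p → lookup⇒[]= w _ (≡.trans (lookup∘tabulate (does ∘ PathIn? W u) w) (dec-true (PathIn? W u w) p)))

  component-cong : ∀ {W a i} → a ∈ W → PathIn G W a i → component W i ≡ component W a
  component-cong a∈W a⇝i = tabulate-cong λ w → does-⇔
    (mk⇔ (a⇝i ++ᵖ_) (PathIn-reverse a∈W a⇝i ++ᵖ_)) (PathIn? _ _ w) (PathIn? _ _ w)

  connected⊆component : ∀ {W A a} → A ⊆ W → Connected G A → a ∈ A → A ⊆ component W a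
  connected⊆component {W} A⊆W conn a∈A i∈A = from (∈component⇔ W _) (PathIn-mono A⊆W (conn _ _ a∈A i∈A))

  component-isComponentOf : ∀ {W u} → u ∈ W → IsComponentOf G W (component W u)
  component-isComponentOf {W} {u} u∈W =
    (u , ⇝⇒∈ here) ,
    (PathIn-end∈ u∈W ∘ ∈⇒⇝) ,
    (λ x y x∈ y∈ → inComponent (∈⇒⇝ x∈) (PathIn-reverse u∈W (∈⇒⇝ x∈) ++ᵖ ∈⇒⇝ y∈)) ,
    (λ C C⊇ C⊆W connC → connected⊆component C⊆W connC (C⊇ (⇝⇒∈ here)))
    where
    ∈⇒⇝ : ∀ {x} → x ∈ component W u → PathIn G W u x
    ∈⇒⇝ = to (∈component⇔ W u)

    ⇝⇒∈ : ∀ {x} → PathIn G W u x → x ∈ component W u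
    ⇝⇒∈ = from (∈component⇔ W u)

    inComponent : ∀ {x y} → PathIn G W u x → PathIn G W x y → PathIn G (component W u) x y
    inComponent u⇝x here           = here
    inComponent u⇝x (step e w∈W p) = step e (⇝⇒∈ u⇝w) (inComponent u⇝w p)
      where
      u⇝w : PathIn G W u _
      u⇝w = u⇝x ++ᵖ step e w∈W here

module _ {c ℓ} (𝒢 : AbelianGroup c ℓ) (G : Graph) where
  open AbelianGroup 𝒢
  open Graph G using (n)

  ZeroAvoidingOn-cong : ∀ {C} {f g : Fin n → Carrier} →
    (∀ i → i ∈ C → f i ≈ g i) → ZeroAvoidingOn G 𝒢 C f → ZeroAvoidingOn G 𝒢 C g
  ZeroAvoidingOn-cong f≈g avoid A A⊆C ne conn gA≈ε =
    avoid A A⊆C ne conn (trans (sumOver-cong 𝒢 A λ i i∈A → f≈g i (A⊆C i∈A)) gA≈ε)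

  zeroAvoidingOn-components : ∀ {W f} →
    (∀ a → a ∈ W → ZeroAvoidingOn G 𝒢 (component G W a) f) → ZeroAvoidingOn G 𝒢 W f
  zeroAvoidingOn-components avoid A A⊆W (a , a∈A) conn =
    avoid a (A⊆W a∈A) A (connected⊆component G A⊆W conn a∈A) (a , a∈A) conn

module _ {c ℓ p} {𝒢 : AbelianGroup c ℓ} {P : AbelianGroup.Carrier 𝒢 → Set p}
         (sg : IsSubgroup 𝒢 P) (G : Graph) where
  open AbelianGroup 𝒢
  open IsSubgroup sg
  open Graph G using (n)

  zeroAvoiding-glue : ∀ X (f : Fin n → Carrier) →
    (∀ A → Nonempty (A ∩ X) → ¬ P (sumOver 𝒢 (A ∩ X) f)) → (∀ i → i ∉ X → P (f i)) →
    ZeroAvoidingOn G 𝒢 (∁ X) f → ZeroAvoiding G 𝒢 f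
  zeroAvoiding-glue X f onX offX avoid A ne conn A≈ε with nonempty? (A ∩ X)
  ... | yes meets = onX A meets (sumOver-∩-∈ sg A X f offX (resp (sym A≈ε) ε-closed))
  ... | no misses = avoid A (λ i∈A → x∉p⇒x∈∁p λ i∈X → misses (_ , x∈p∩q⁺ (i∈A , i∈X))) ne conn A≈ε

  AvoidingLabelling : Subset n → (Fin n → Carrier) → Set (ℓ ⊔ p)
  AvoidingLabelling C f = (∀ v → v ∈ C → P (f v)) × ZeroAvoidingOn G 𝒢 C f

  AvoidingLabelling-cong : ∀ {C} {f g : Fin n → Carrier} →
    (∀ i → f i ≈ g i) → AvoidingLabelling C f → AvoidingLabelling C g
  AvoidingLabelling-cong f≈g (f∈P , avoid) =
    (λ v v∈C → resp (f≈g v) (f∈P v v∈C)) , ZeroAvoidingOn-cong 𝒢 G (λ i _ → f≈g i) avoid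

  module _ (fin : IsFinite 𝒢) (P? : ∀ x → Dec (P x)) where
    open Finite fin

    zeroAvoidingOn? : ∀ W f → Dec (ZeroAvoidingOn G 𝒢 W f)
    zeroAvoidingOn? W f = map′ {A = ¬ ∃ ZeroConnectedSet}
      (λ ¬zero A A⊆W ne conn A≈ε → ¬zero (A , A⊆W , ne , conn , A≈ε))
      (λ avoid (A , A⊆W , ne , conn , A≈ε) → avoid A A⊆W ne conn A≈ε)
      (¬? (anySubset? zeroConnectedSet?))
      where
      ZeroConnectedSet : Subset n → Set ℓ
      ZeroConnectedSet A = A ⊆ W × Nonempty A × Connected G A × sumOver 𝒢 A f ≈ ε

      zeroConnectedSet? : ∀ A → Dec (ZeroConnectedSet A)
      zeroConnectedSet? A = A ⊆? W ×-dec nonempty? A ×-dec Connected? G A ×-dec sumOver 𝒢 A f ≈? ε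

    avoidingLabelling? : ∀ C f → Dec (AvoidingLabelling C f)
    avoidingLabelling? C f = all? (λ v → v ∈? C →-dec P? (f v)) ×-dec zeroAvoidingOn? C f

    zeroForcingOn-or-labelling : ∀ C → ZeroForcingOn G 𝒢 C P ⊎ ∃ (AvoidingLabelling C)
    zeroForcingOn-or-labelling C with anySequence? AvoidingLabelling-cong (avoidingLabelling? C)
    ... | yes labelling = inj₂ labelling
    ... | no ¬labelling = inj₁ λ f f∈P avoid → ¬labelling (f , f∈P , avoid)

    zeroForcingOn? : ∀ C → Dec (ZeroForcingOn G 𝒢 C P)
    zeroForcingOn? C with zeroForcingOn-or-labelling C
    ... | inj₁ zf                = yes zf
    ... | inj₂ (f , f∈P , avoid) = no λ zf → zf f f∈P avoid

    -- On a zero-forcing C the labelling is junk; it is only used where C is not.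
    labellingOf : Subset n → Fin n → Carrier
    labellingOf C with zeroForcingOn-or-labelling C
    ... | inj₁ _       = λ _ → ε
    ... | inj₂ (f , _) = f

    labellingOf-avoiding : ∀ C → ¬ ZeroForcingOn G 𝒢 C P → AvoidingLabelling C (labellingOf C)
    labellingOf-avoiding C ¬zf with zeroForcingOn-or-labelling C
    ... | inj₁ zf             = ⊥-elim (¬zf zf)
    ... | inj₂ (_ , avoiding) = avoiding

    module _ (X : Subset n) {s : Fin ∣ X ∣ → Carrier} (s-free : ¬ HasSubsumIn 𝒢 P s) where
      private
        componentOf : Fin n → Subset n
        componentOf = component G (∁ X)

      glued : Fin n → Carrier
      glued u with u ∈? X
      ... | yes _ = spread 𝒢 X s u
      ... | no  _ = labellingOf (componentOf u) u

      glued-∈ : ∀ {u} → u ∈ X → glued u ≡ spread 𝒢 X s u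
      glued-∈ {u} u∈X with u ∈? X
      ... | yes _   = ≡.refl
      ... | no u∉X = ⊥-elim (u∉X u∈X)

      glued-∉ : ∀ {u} → u ∉ X → glued u ≡ labellingOf (componentOf u) u
      glued-∉ {u} u∉X with u ∈? X
      ... | yes u∈X = ⊥-elim (u∉X u∈X)
      ... | no _    = ≡.refl

      glued-onX : ∀ A → Nonempty (A ∩ X) → ¬ P (sumOver 𝒢 (A ∩ X) glued)
      glued-onX A meets A∩X∈P = s-free (compress X A , compress-nonempty X A meets , resp
        (trans (sumOver-cong 𝒢 (A ∩ X) λ i i∈ → reflexive (glued-∈ (proj₂ (x∈p∩q⁻ A X i∈))))
               (sumOver-spread 𝒢 X A s))
        A∩X∈P)

      module _ (¬zf : ∀ u → u ∈ ∁ X → ¬ ZeroForcingOn G 𝒢 (componentOf u) P) where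
        glued-offX : ∀ i → i ∉ X → P (glued i)
        glued-offX i i∉X rewrite glued-∉ i∉X =
          proj₁ (labellingOf-avoiding _ (¬zf i (x∉p⇒x∈∁p i∉X))) i (from (∈component⇔ G (∁ X) i) here)

        glued-onComponent : ∀ a → a ∈ ∁ X → ZeroAvoidingOn G 𝒢 (componentOf a) glued
        glued-onComponent a a∉X =
          ZeroAvoidingOn-cong 𝒢 G agree (proj₂ (labellingOf-avoiding _ (¬zf a a∉X)))
          where
          agree : ∀ i → i ∈ componentOf a → labellingOf (componentOf a) i ≈ glued i
          agree i i∈ = reflexive (≡.sym (≡.trans (glued-∉ (x∈∁p⇒x∉p (PathIn-end∈ G a∉X a⇝i)))
                                                 (cong (λ C → labellingOf C i) (component-cong G a∉X a⇝i))))
            where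
            a⇝i : PathIn G (∁ X) a i
            a⇝i = to (∈component⇔ G (∁ X) a) i∈

        glued-zeroAvoiding : ZeroAvoiding G 𝒢 glued
        glued-zeroAvoiding =
          zeroAvoiding-glue X glued glued-onX glued-offX (zeroAvoidingOn-components 𝒢 G glued-onComponent)

      zeroForcing⇒zeroForcingComponent : ZeroForcing G 𝒢 →
        Σ (Subset n) λ C → IsComponentOf G (∁ X) C × ZeroForcingOn G 𝒢 C P
      zeroForcing⇒zeroForcingComponent zf
        with any? (λ u → u ∈? ∁ X ×-dec zeroForcingOn? (componentOf u))
      ... | yes (u , u∉X , zfC) = componentOf u , component-isComponentOf G u∉X , zfC
      ... | no none = ⊥-elim (zf glued (glued-zeroAvoiding λ u u∉X zfC → none (u , u∉X , zfC)))

lemma4p2 : ∀ {c ℓ p} (𝒢 : AbelianGroup c ℓ) → IsFinite 𝒢 →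
    (P : AbelianGroup.Carrier 𝒢 → Set p) (sg : IsSubgroup 𝒢 P) →
    (G : Graph) (X : Subset (Graph.n G)) →
    (d : ℕ) → IsDavenportConstant (quotient 𝒢 sg) d → ∣ X ∣ < d →
    ZeroForcing G 𝒢 →
    Σ (Subset (Graph.n G)) λ C →
      IsComponentOf G (∁ X) C × ZeroForcingOn G 𝒢 C P
lemma4p2 𝒢 fin P sg G X d dav ∣X∣<d =
  zeroForcing⇒zeroForcingComponent sg G fin (∈-dec fin sg dav) X
    (proj₂ (zeroSumFree-sequence fin sg dav ∣X∣<d))
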